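{- Suppose $\Delta$ is a pasting context, $\Gamma\vdash\sigma:\Delta$, and $\alpha$ is a locally maximal variable of $\Delta$ such that $\alpha[\sigma]\equiv\mathsf{i}_k[\tau]$ for some $k$ and $\tau$. Then $\Delta/\!\!/\alpha\vdash\pi_\alpha:\Delta$, $\Gamma\vdash\sigma/\!\!/\alpha:\Delta/\!\!/\alpha$, and $\Gamma\vdash\sigma=\pi_\alpha\circ(\sigma/\!\!/\alpha)$ in $\mathrm{Catt}_{\mathrm{su}}$.
   Context: The type theory $\mathrm{Catt}_{\mathrm{su}}$. Fix an infinite set $V$ of variables containing distinct $d_i,d_i'$ ($i\in\mathbb N$). Raw syntax: contexts $\Gamma::=\emptyset\mid\Gamma,x:A$; types $A::=\star\mid s\to_A t$; terms $t::=x\mid\mathsf{coh}(\Gamma:A)[\sigma]$; substitutions $\sigma::=\langle\rangle\mid\langle\sigma,x\mapsto t\rangle$. $\equiv$ is syntactic equality up to $\alpha$-equivalence; $\mathrm{FV}$ free variables ($\mathrm{FV}(\mathsf{coh}(\Gamma:A)[\sigma])=\mathrm{FV}(\sigma)$; $\mathrm{FV}(\Gamma)$ the variables of $\Gamma$). Substitution: $\star[\sigma]=\star$, $(s\to_A t)[\sigma]=s[\sigma]\to_{A[\sigma]}t[\sigma]$, $x[\sigma]$ the entry for $x$, $\mathsf{coh}(\Gamma:A)[\tau][\sigma]=\mathsf{coh}(\Gamma:A)[\tau\circ\sigma]$, $\langle\rangle\circ\sigma=\langle\rangle$, $\langle\tau,x\mapsto t\rangle\circ\sigma=\langle\tau\circ\sigma,x\mapsto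 t[\sigma]\rangle$; $\mathrm{id}_\Gamma$ identity. $\dim\star=-1$, $\dim(s\to_A t)=\dim A+1$, variable $x:A$ has dimension $\dim A+1$, $\dim\emptyset=-1$, $\dim(\Gamma,x:A)=\max(\dim\Gamma,\dim A+1)$. Typing: $\emptyset\vdash$; $\Gamma,x:A\vdash$ from $\Gamma\vdash A$; $\Gamma\vdash\star$; $\Gamma\vdash s\to_A t$ from $\Gamma\vdash A,\Gamma\vdash s:A,\Gamma\vdash t:A$; $\Gamma\vdash\langle\rangle:\emptyset$; $\Gamma\vdash\langle\sigma,x\mapsto t\rangle:(\Delta,x:A)$ from $\Gamma\vdash\sigma:\Delta,\Delta\vdash A,\Gamma\vdash t:A[\sigma]$; $\Gamma\vdash x:A$ for $(x:A)\in\Gamma$; conversion; coherence rule: if $\Gamma\vdash_p$, $\Gamma\vdash s\to_A t$, $\Delta\vdash\sigma:\Gamma$, and either ($\mathrm{supp}(s)=\partial^-(\Gamma)$, $\mathrm{supp}(t)=\partial^+(\Gamma)$) or $\mathrm{supp}(s)=\mathrm{supp}(t)=\mathrm{FV}(\Gamma)$, then $\Delta\vdash\mathsf{coh}(\Gamma:s\to_A t)[\sigma]:s[\sigma]\to_{A[\sigma]}t[\sigma]$. Pasting contexts: $(x:\star)\vdash_p x:\star$; $\Gamma\vdash_p x:A\Rightarrow\Gamma,y:A,f:x\to_A y\vdash_p f:x\to_A y$ (introduction); $\Gamma\vdash_p f:x\to_A y\Rightarrow\Gamma\vdash_p y:A$ (descent); $\Gamma\vdash_p$ if $\Gamma\vdash_p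 x:\star$. $\partial^\mp(\Gamma)$: variables of dimension $<\dim\Gamma-1$ plus those of dimension $\dim\Gamma-1$ not the target (resp. source) of another variable. $\mathrm{supp}$: downward closure of free variables. Discs: $D^0=(d_0:\star)$, $S^{ -1}=\star$, $D^{k+1}=D^k,(d_k':S^{k-1}),(d_{k+1}:S^k)$, $S^k=d_k\to_{S^{k-1}}d_k'$; $\mathsf{i}_k:=\mathsf{coh}(D^k:d_k\to_{S^{k-1}}d_k)[\mathrm{id}_{D^k}]$; identity terms: syntactically $\mathsf{i}_k[\tau]$. $\{\star,t\}=\langle t\rangle$, $\{u\to_A v,t\}=\langle\{A,u\},v,t\rangle$. Pruning data: locally maximal variables of a pasting context $\Delta$ are those introduced by an introduction step immediately followed by a descent step in its derivation. For locally maximal $\alpha:s\to_A t$: $\Delta/\!\!/\alpha$ is the pasting context obtained by deleting $t$ and $\alpha$ (removing that introduction step and the following descent step); $\pi_\alpha$ sends $\alpha\mapsto\mathsf{i}_{\dim A+1}[\{A,s\}]$, $t\mapsto s$ and every other variable to itself; for $\sigma$ out of $\Delta$, $\sigma/\!\!/\alpha$ is $\sigma$ with the entries for $t$ and $\alpha$ removed. Definitional equality $\Gamma\vdash s=t$: smallest relation containing $x=x$, closed under symmetry, transitivity and congruence for $\mathsf{coh}$, generated by (prune) $\mathsf{coh}(\Delta:A)[\sigma]=\mathsf{coh}(\Delta/\!\!/\alpha:A[\pi_\alpha])[\sigma/\!\!/\alpha]$ if well typed, $\alpha$ locally maximal, $\alpha[\sigma]$ an identity; (disc) $\mathsf{coh}(D^{n+1}:S^n)[\sigma]=d_{n+1}[\sigma]$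 when well typed; (endo) $\mathsf{coh}(\Delta:t\to_A t)[\sigma]=\mathsf{i}_{\dim A+1}[\{A,t\}\circ\sigma]$ when well typed; induced componentwise on types and substitutions. -}

module Defs where

-- Well-scoped syntax of Catt_su with de Bruijn INDICES (Fin n, zero = the
-- most recently bound variable).  Up-to-alpha syntactic equality of the
-- paper becomes Agda's propositional equality _≡_.

open import Data.Nat using (ℕ; zero; suc)
open import Data.Fin using (Fin; zero; suc)
open import Data.Integer using (ℤ; +_; -1ℤ; 1ℤ; _+_; _-_; _⊔_; _<_)
open import Data.Product using (Σ; _×_; _,_)
open import Data.Sum using (_⊎_)
open import Data.Unit using (⊤)
open import Relation.Nullary using (¬_)
open import Relation.Binary.PropositionalEquality using (_≡_)

-- Raw syntax
--   Ctx n      : contexts with n variables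
--   Ty n, Tm n : types / terms with free variables among n
--   Sub n m    : substitutions from a context of length n into terms over m
--                (⟨ σ , t ⟩ is ⟨σ, x ↦ t⟩ for the last variable x)

data Ctx : ℕ → Set
data Ty : ℕ → Set
data Tm : ℕ → Set
data Sub : ℕ → ℕ → Set

data Ctx where
  ∅ : Ctx 0
  _▸_ : ∀ {n} → Ctx n → Ty n → Ctx (suc n)

infixl 5 _▸_

data Ty where
  ⋆ : ∀ {n} → Ty n
  _─⟨_⟩⟶_ : ∀ {n} → Tm n → Ty n → Tm n → Ty n

data Tm where
  Var : ∀ {n} → Fin n → Tm n
  Coh : ∀ {k m} → Ctx k → Ty k → Sub k m → Tm m

data Sub where
  ⟨⟩ : ∀ {m} → Sub 0 m
  ⟨_,_⟩ : ∀ {n m} → Sub n m → Tm m → Sub (suc n) m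

wkTm : ∀ {n} → Tm n → Tm (suc n)
wkSub : ∀ {n m} → Sub n m → Sub n (suc m)

wkTm (Var i) = Var (suc i)
wkTm (Coh Γ A τ) = Coh Γ A (wkSub τ)

wkSub ⟨⟩ = ⟨⟩
wkSub ⟨ σ , t ⟩ = ⟨ wkSub σ , wkTm t ⟩

wkTy : ∀ {n} → Ty n → Ty (suc n)
wkTy ⋆ = ⋆
wkTy (s ─⟨ A ⟩⟶ t) = wkTm s ─⟨ wkTy A ⟩⟶ wkTm t

idSub : ∀ {n} → Sub n n
idSub {zero} = ⟨⟩
idSub {suc n} = ⟨ wkSub idSub , Var zero ⟩

varTy : ∀ {n} → Ctx n → Fin n → Ty n
varTy (Γ ▸ A) zero = wkTy A
varTy (Γ ▸ A) (suc i) = wkTy (varTy Γ i)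

_[_]tm : ∀ {n m} → Tm n → Sub n m → Tm m
_∘_ : ∀ {n k m} → Sub n k → Sub k m → Sub n m

lookupSub : ∀ {n m} → Sub n m → Fin n → Tm m
lookupSub ⟨ σ , t ⟩ zero = t
lookupSub ⟨ σ , t ⟩ (suc i) = lookupSub σ i

Var i [ σ ]tm = lookupSub σ i
Coh Γ A τ [ σ ]tm = Coh Γ A (τ ∘ σ)

⟨⟩ ∘ σ = ⟨⟩
⟨ τ , t ⟩ ∘ σ = ⟨ τ ∘ σ , t [ σ ]tm ⟩

_[_]ty : ∀ {n m} → Ty n → Sub n m → Ty m
⋆ [ σ ]ty = ⋆
(s ─⟨ A ⟩⟶ t) [ σ ]ty = (s [ σ ]tm) ─⟨ A [ σ ]ty ⟩⟶ (t [ σ ]tm)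

dimTy : ∀ {n} → Ty n → ℤ
dimTy ⋆ = -1ℤ
dimTy (s ─⟨ A ⟩⟶ t) = dimTy A + 1ℤ

dimVar : ∀ {n} → Ctx n → Fin n → ℤ
dimVar Γ i = dimTy (varTy Γ i) + 1ℤ

dimCtx : ∀ {n} → Ctx n → ℤ
dimCtx ∅ = -1ℤ
dimCtx (Γ ▸ A) = dimCtx Γ ⊔ (dimTy A + 1ℤ)

dim+1 : ∀ {n} → Ty n → ℕ
dim+1 ⋆ = zero
dim+1 (s ─⟨ A ⟩⟶ t) = suc (dim+1 A)

data _∈FVtm_ : ∀ {n} → Fin n → Tm n → Set
data _∈FVsub_ : ∀ {k n} → Fin n → Sub k n → Set

data _∈FVtm_ where
  fv-var : ∀ {n} {i : Fin n} → i ∈FVtm Var i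
  fv-coh : ∀ {k n} {i : Fin n} {Δ : Ctx k} {A : Ty k} {σ : Sub k n} →
           i ∈FVsub σ → i ∈FVtm Coh Δ A σ

data _∈FVsub_ where
  fv-head : ∀ {k n} {i : Fin n} {σ : Sub k n} {t : Tm n} →
            i ∈FVtm t → i ∈FVsub ⟨ σ , t ⟩
  fv-tail : ∀ {k n} {i : Fin n} {σ : Sub k n} {t : Tm n} →
            i ∈FVsub σ → i ∈FVsub ⟨ σ , t ⟩

data _∈FVty_ {n : ℕ} (i : Fin n) : Ty n → Set where
  fv-src : ∀ {s A t} → i ∈FVtm s → i ∈FVty (s ─⟨ A ⟩⟶ t)
  fv-base : ∀ {s A t} → i ∈FVty A → i ∈FVty (s ─⟨ A ⟩⟶ t)
  fv-tgt : ∀ {s A t} → i ∈FVtm t → i ∈FVty (s ─⟨ A ⟩⟶ t)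

-- supp(t) in Γ: downward closure of FV(t) (closing under the free variables
-- of the types of variables already in the set)
data InSupp {n : ℕ} (Γ : Ctx n) (t : Tm n) : Fin n → Set where
  supp-fv : ∀ {i} → i ∈FVtm t → InSupp Γ t i
  supp-down : ∀ {i j} → InSupp Γ t i → j ∈FVty varTy Γ i → InSupp Γ t j

_≐_ : ∀ {n} → (Fin n → Set) → (Fin n → Set) → Set
P ≐ Q = ∀ i → (P i → Q i) × (Q i → P i)

IsTargetOfVar : ∀ {n} → Ctx n → Fin n → Set
IsTargetOfVar {n} Γ x =
  Σ (Fin n) λ y → Σ (Tm n) λ s → Σ (Ty n) λ A → varTy Γ y ≡ (s ─⟨ A ⟩⟶ Var x)

IsSourceOfVar : ∀ {n} → Ctx n → Fin n → Set
IsSourceOfVar {n} Γ x =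
  Σ (Fin n) λ y → Σ (Tm n) λ t → Σ (Ty n) λ A → varTy Γ y ≡ (Var x ─⟨ A ⟩⟶ t)

∂⁻ : ∀ {n} → Ctx n → Fin n → Set
∂⁻ Γ x = (dimVar Γ x < dimCtx Γ - 1ℤ)
       ⊎ ((dimVar Γ x ≡ dimCtx Γ - 1ℤ) × ¬ IsTargetOfVar Γ x)

∂⁺ : ∀ {n} → Ctx n → Fin n → Set
∂⁺ Γ x = (dimVar Γ x < dimCtx Γ - 1ℤ)
       ⊎ ((dimVar Γ x ≡ dimCtx Γ - 1ℤ) × ¬ IsSourceOfVar Γ x)

FVctx : ∀ {n} → Ctx n → Fin n → Set
FVctx Γ x = ⊤

data _⊢p_∶_ : ∀ {n} → Ctx n → Tm n → Ty n → Set where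
  pc-base : (∅ ▸ ⋆) ⊢p Var zero ∶ ⋆
  -- introduction:  Γ ⊢p x : A  ⟹  Γ, y : A, f : x →_A y ⊢p f : x →_A y
  pc-intro : ∀ {n} {Γ : Ctx n} {x : Tm n} {A : Ty n} →
    Γ ⊢p x ∶ A →
    (Γ ▸ A ▸ (wkTm x ─⟨ wkTy A ⟩⟶ Var zero))
      ⊢p Var zero ∶ (wkTm (wkTm x) ─⟨ wkTy (wkTy A) ⟩⟶ Var (suc zero))
  pc-descent : ∀ {n} {Γ : Ctx n} {f x y : Tm n} {A : Ty n} →
    Γ ⊢p f ∶ (x ─⟨ A ⟩⟶ y) → Γ ⊢p y ∶ A

data _⊢p {n : ℕ} (Γ : Ctx n) : Set where
  pc : ∀ {x} → Γ ⊢p x ∶ ⋆ → Γ ⊢p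

-- Locally maximal variables: positions in the pasting derivation where an
-- introduction step is immediately followed by a descent step.
-- (Such a derivation necessarily lives over a context of length ≥ 2.)
data LocMax : ∀ {n} {Γ : Ctx (suc (suc n))} {x : Tm (suc (suc n))}
                {A : Ty (suc (suc n))} → Γ ⊢p x ∶ A → Set where
  lm-here : ∀ {n} {Γ : Ctx n} {x : Tm n} {A : Ty n} (d : Γ ⊢p x ∶ A) →
    LocMax (pc-descent (pc-intro d))
  lm-intro : ∀ {n} {Γ : Ctx (suc (suc n))} {x A} {d : Γ ⊢p x ∶ A} →
    LocMax d → LocMax (pc-intro d)
  lm-descent : ∀ {n} {Γ : Ctx (suc (suc n))} {f x y A}
    {d : Γ ⊢p f ∶ (x ─⟨ A ⟩⟶ y)} →
    LocMax d → LocMax (pc-descent d)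

LocMaxVar : ∀ {n} {Γ : Ctx (suc (suc n))} → Γ ⊢p → Set
LocMaxVar (pc d) = LocMax d

lmVar' : ∀ {n} {Γ : Ctx (suc (suc n))} {x A} {d : Γ ⊢p x ∶ A} →
  LocMax d → Fin (suc (suc n))
lmVar' (lm-here d) = zero
lmVar' (lm-intro p) = suc (suc (lmVar' p))
lmVar' (lm-descent p) = lmVar' p

lmVar : ∀ {n} {Γ : Ctx (suc (suc n))} {P : Γ ⊢p} → LocMaxVar P → Fin (suc (suc n))
lmVar {P = pc d} α = lmVar' α

-- |D^k| = 2k+1
twice : ℕ → ℕ
twice zero = zero
twice (suc k) = suc (suc (twice k))

dsz : ℕ → ℕ
dsz k = suc (twice k)

-- Sph k : S^{k-1} as a type over D^k (the type of d_k)
-- Sph' k : S^k = d_k →_{S^{k-1}} d_k' as a type over D^k, d_k'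
D : (k : ℕ) → Ctx (dsz k)
Sph : (k : ℕ) → Ty (dsz k)
Sph' : (k : ℕ) → Ty (suc (dsz k))

D zero = ∅ ▸ ⋆
D (suc k) = D k ▸ Sph k ▸ Sph' k

Sph zero = ⋆
Sph (suc k) = wkTy (Sph' k)

Sph' k = Var (suc zero) ─⟨ wkTy (Sph k) ⟩⟶ Var zero

𝕚 : (k : ℕ) → Tm (dsz k)
𝕚 k = Coh (D k) (Var zero ─⟨ Sph k ⟩⟶ Var zero) idSub

discSub : ∀ {m} (A : Ty m) → Tm m → Sub (dsz (dim+1 A)) m
discSub ⋆ t = ⟨ ⟨⟩ , t ⟩
discSub (u ─⟨ A ⟩⟶ v) t = ⟨ ⟨ discSub A u , v ⟩ , t ⟩

IsIdentity : ∀ {m} → Tm m → Set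
IsIdentity {m} t = Σ ℕ λ k → Σ (Sub (dsz k) m) λ τ → t ≡ 𝕚 k [ τ ]tm

prunedCtx' : ∀ {n} {Γ : Ctx (suc (suc n))} {x A} {d : Γ ⊢p x ∶ A} →
  LocMax d → Ctx n
π' : ∀ {n} {Γ : Ctx (suc (suc n))} {x A} {d : Γ ⊢p x ∶ A} →
  LocMax d → Sub (suc (suc n)) n

prunedCtx' (lm-here {Γ = Γ} d) = Γ
prunedCtx' (lm-intro {x = x} {A = A} p) =
  prunedCtx' p ▸ (A [ π' p ]ty) ▸
    (wkTm (x [ π' p ]tm) ─⟨ wkTy (A [ π' p ]ty) ⟩⟶ Var zero)
prunedCtx' (lm-descent p) = prunedCtx' p

-- lm-here: α : x →_A y (x, A over the context before y, α);
--   π sends α ↦ i_{dim A+1}[{A,x}], y ↦ x, others to themselves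
π' (lm-here {x = x} {A = A} d) =
  ⟨ ⟨ idSub , x ⟩ , 𝕚 (dim+1 A) [ discSub A x ]tm ⟩
π' (lm-intro p) = ⟨ ⟨ wkSub (wkSub (π' p)) , Var (suc zero) ⟩ , Var zero ⟩
π' (lm-descent p) = π' p

-- σ//α : drop the entries for y (the target of α) and α
prunedSub' : ∀ {n m} {Γ : Ctx (suc (suc n))} {x A} {d : Γ ⊢p x ∶ A} →
  LocMax d → Sub (suc (suc n)) m → Sub n m
prunedSub' (lm-here d) ⟨ ⟨ σ , _ ⟩ , _ ⟩ = σ
prunedSub' (lm-intro p) ⟨ ⟨ σ , a ⟩ , b ⟩ = ⟨ ⟨ prunedSub' p σ , a ⟩ , b ⟩
prunedSub' (lm-descent p) σ = prunedSub' p σ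

_//_ : ∀ {n} (Δ : Ctx (suc (suc n))) {P : Δ ⊢p} → LocMaxVar P → Ctx n
_//_ Δ {pc d} α = prunedCtx' α

π[_] : ∀ {n} {Δ : Ctx (suc (suc n))} {P : Δ ⊢p} → LocMaxVar P → Sub (suc (suc n)) n
π[_] {P = pc d} α = π' α

_//s_ : ∀ {n m} {Δ : Ctx (suc (suc n))} {P : Δ ⊢p} →
  Sub (suc (suc n)) m → LocMaxVar P → Sub n m
_//s_ {P = pc d} σ α = prunedSub' α σ

data _⊢ty_ : ∀ {n} → Ctx n → Ty n → Set
data _⊢_∶_ : ∀ {n} → Ctx n → Tm n → Ty n → Set
data _⊢s_∶_ : ∀ {n m} → Ctx m → Sub n m → Ctx n → Set
data _⊢_≈_ : ∀ {n} → Ctx n → Tm n → Tm n → Set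
data _⊢_≈ty_ : ∀ {n} → Ctx n → Ty n → Ty n → Set
data _⊢_≈s_ : ∀ {n m} → Ctx m → Sub n m → Sub n m → Set

SuppCond : ∀ {n} → Ctx n → Tm n → Tm n → Set
SuppCond Γ s t = ((InSupp Γ s ≐ ∂⁻ Γ) × (InSupp Γ t ≐ ∂⁺ Γ))
               ⊎ ((InSupp Γ s ≐ FVctx Γ) × (InSupp Γ t ≐ FVctx Γ))

data _⊢ty_ where
  ty-star : ∀ {n} {Γ : Ctx n} → Γ ⊢ty ⋆
  ty-arr : ∀ {n} {Γ : Ctx n} {s A t} →
    Γ ⊢ty A → Γ ⊢ s ∶ A → Γ ⊢ t ∶ A → Γ ⊢ty (s ─⟨ A ⟩⟶ t)

data _⊢_∶_ where
  tm-var : ∀ {n} {Γ : Ctx n} (i : Fin n) → Γ ⊢ Var i ∶ varTy Γ i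
  tm-conv : ∀ {n} {Γ : Ctx n} {t A B} → Γ ⊢ t ∶ A → Γ ⊢ A ≈ty B → Γ ⊢ t ∶ B
  tm-coh : ∀ {k m} {Δ : Ctx k} {Γ : Ctx m} {s t : Tm k} {A : Ty k} {σ : Sub k m} →
    Δ ⊢p → Δ ⊢ty (s ─⟨ A ⟩⟶ t) → Γ ⊢s σ ∶ Δ → SuppCond Δ s t →
    Γ ⊢ Coh Δ (s ─⟨ A ⟩⟶ t) σ ∶ ((s [ σ ]tm) ─⟨ A [ σ ]ty ⟩⟶ (t [ σ ]tm))

data _⊢s_∶_ where
  sub-empty : ∀ {m} {Γ : Ctx m} → Γ ⊢s ⟨⟩ ∶ ∅
  sub-ext : ∀ {n m} {Γ : Ctx m} {Δ : Ctx n} {σ : Sub n m} {A : Ty n} {t : Tm m} →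
    Γ ⊢s σ ∶ Δ → Δ ⊢ty A → Γ ⊢ t ∶ (A [ σ ]ty) → Γ ⊢s ⟨ σ , t ⟩ ∶ (Δ ▸ A)

data _⊢_≈_ where
  eq-var : ∀ {n} {Γ : Ctx n} (i : Fin n) → Γ ⊢ Var i ≈ Var i
  eq-sym : ∀ {n} {Γ : Ctx n} {s t} → Γ ⊢ s ≈ t → Γ ⊢ t ≈ s
  eq-trans : ∀ {n} {Γ : Ctx n} {s t u} → Γ ⊢ s ≈ t → Γ ⊢ t ≈ u → Γ ⊢ s ≈ u
  eq-coh : ∀ {k m} {Γ : Ctx m} {Δ : Ctx k} {A B : Ty k} {σ τ : Sub k m} →
    Δ ⊢ A ≈ty B → Γ ⊢ σ ≈s τ → Γ ⊢ Coh Δ A σ ≈ Coh Δ B τ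
  eq-prune : ∀ {n m} {Γ : Ctx m} {Δ : Ctx (suc (suc n))} {A : Ty (suc (suc n))}
    {σ : Sub (suc (suc n)) m} {B : Ty m} (P : Δ ⊢p) (α : LocMaxVar P) →
    IsIdentity (Var (lmVar α) [ σ ]tm) →
    Γ ⊢ Coh Δ A σ ∶ B →
    Γ ⊢ Coh Δ A σ ≈ Coh (Δ // α) (A [ π[ α ] ]ty) (σ //s α)
  eq-disc : ∀ {m} {Γ : Ctx m} (k : ℕ) {σ : Sub (dsz (suc k)) m} {B : Ty m} →
    Γ ⊢ Coh (D (suc k)) (Sph (suc k)) σ ∶ B →
    Γ ⊢ Coh (D (suc k)) (Sph (suc k)) σ ≈ (Var zero [ σ ]tm)
  eq-endo : ∀ {k m} {Γ : Ctx m} {Δ : Ctx k} {t : Tm k} {A : Ty k}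
    {σ : Sub k m} {B : Ty m} →
    Γ ⊢ Coh Δ (t ─⟨ A ⟩⟶ t) σ ∶ B →
    Γ ⊢ Coh Δ (t ─⟨ A ⟩⟶ t) σ ≈ (𝕚 (dim+1 A) [ discSub A t ∘ σ ]tm)

data _⊢_≈ty_ where
  eqty-star : ∀ {n} {Γ : Ctx n} → Γ ⊢ ⋆ ≈ty ⋆
  eqty-arr : ∀ {n} {Γ : Ctx n} {s s' A A' t t'} →
    Γ ⊢ s ≈ s' → Γ ⊢ A ≈ty A' → Γ ⊢ t ≈ t' → Γ ⊢ (s ─⟨ A ⟩⟶ t) ≈ty (s' ─⟨ A' ⟩⟶ t')

data _⊢_≈s_ where
  eqs-empty : ∀ {m} {Γ : Ctx m} → Γ ⊢ ⟨⟩ ≈s ⟨⟩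
  eqs-ext : ∀ {n m} {Γ : Ctx m} {σ τ : Sub n m} {s t} →
    Γ ⊢ σ ≈s τ → Γ ⊢ s ≈ t → Γ ⊢ ⟨ σ , s ⟩ ≈s ⟨ τ , t ⟩

module Submission where

-- All three claims go by induction on the position of α in the pasting
-- derivation.  Only the base case has content: α is the last variable,
-- α : x →_A y, and σ = ⟨σ', y ↦ b, α ↦ a⟩ with a ≡ i_k[τ] of type
-- x[σ'] → b.  Inverting the typing of this identity shows b = x[σ'] and that
-- τ is, up to definitional equality, the disc substitution {A,x} ∘ σ'
-- (lemma disc-determined); this is exactly the value π_α ∘ σ' prescribes.

open import Defs
open import Data.Nat using (zero; suc)
open import Data.Fin using (Fin; zero; suc)
open import Data.Product using (Σ; _×_; _,_; proj₁; proj₂)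
open import Data.Sum using (inj₂)
open import Data.Unit using (tt)
open import Relation.Binary.PropositionalEquality
  using (_≡_; refl; sym; trans; cong; cong₂; subst)

arr-cong : ∀ {n} {s s' : Tm n} {A A' t t'} → s ≡ s' → A ≡ A' → t ≡ t' →
  (s ─⟨ A ⟩⟶ t) ≡ (s' ─⟨ A' ⟩⟶ t')
arr-cong refl refl refl = refl

wk-ext-tm : ∀ {n m} (t : Tm n) (σ : Sub n m) u → wkTm t [ ⟨ σ , u ⟩ ]tm ≡ t [ σ ]tm
wk-ext-sub : ∀ {k n m} (τ : Sub k n) (σ : Sub n m) u → wkSub τ ∘ ⟨ σ , u ⟩ ≡ τ ∘ σ
wk-ext-tm (Var i) σ u = refl
wk-ext-tm (Coh Δ A τ) σ u = cong (Coh Δ A) (wk-ext-sub τ σ u)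
wk-ext-sub ⟨⟩ σ u = refl
wk-ext-sub ⟨ τ , t ⟩ σ u = cong₂ ⟨_,_⟩ (wk-ext-sub τ σ u) (wk-ext-tm t σ u)

wk-ext-ty : ∀ {n m} (A : Ty n) (σ : Sub n m) u → wkTy A [ ⟨ σ , u ⟩ ]ty ≡ A [ σ ]ty
wk-ext-ty ⋆ σ u = refl
wk-ext-ty (s ─⟨ A ⟩⟶ t) σ u = arr-cong (wk-ext-tm s σ u) (wk-ext-ty A σ u) (wk-ext-tm t σ u)

wk²-ext-tm : ∀ {n m} (t : Tm n) (σ : Sub n m) a b →
  wkTm (wkTm t) [ ⟨ ⟨ σ , a ⟩ , b ⟩ ]tm ≡ t [ σ ]tm
wk²-ext-tm t σ a b = trans (wk-ext-tm (wkTm t) ⟨ σ , a ⟩ b) (wk-ext-tm t σ a)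

wk²-ext-ty : ∀ {n m} (A : Ty n) (σ : Sub n m) a b →
  wkTy (wkTy A) [ ⟨ ⟨ σ , a ⟩ , b ⟩ ]ty ≡ A [ σ ]ty
wk²-ext-ty A σ a b = trans (wk-ext-ty (wkTy A) ⟨ σ , a ⟩ b) (wk-ext-ty A σ a)

wk²-ext-sub : ∀ {k n m} (τ : Sub k n) (σ : Sub n m) a b →
  wkSub (wkSub τ) ∘ ⟨ ⟨ σ , a ⟩ , b ⟩ ≡ τ ∘ σ
wk²-ext-sub τ σ a b = trans (wk-ext-sub (wkSub τ) ⟨ σ , a ⟩ b) (wk-ext-sub τ σ a)

lookup-wk : ∀ {n m} (σ : Sub n m) i → lookupSub (wkSub σ) i ≡ wkTm (lookupSub σ i)
lookup-wk ⟨ σ , t ⟩ zero = refl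
lookup-wk ⟨ σ , t ⟩ (suc i) = lookup-wk σ i

sub-wk-tm : ∀ {n m} (t : Tm n) (σ : Sub n m) → t [ wkSub σ ]tm ≡ wkTm (t [ σ ]tm)
∘-wk : ∀ {k n m} (τ : Sub k n) (σ : Sub n m) → τ ∘ wkSub σ ≡ wkSub (τ ∘ σ)
sub-wk-tm (Var i) σ = lookup-wk σ i
sub-wk-tm (Coh Δ A τ) σ = cong (Coh Δ A) (∘-wk τ σ)
∘-wk ⟨⟩ σ = refl
∘-wk ⟨ τ , t ⟩ σ = cong₂ ⟨_,_⟩ (∘-wk τ σ) (sub-wk-tm t σ)

sub-wk-ty : ∀ {n m} (A : Ty n) (σ : Sub n m) → A [ wkSub σ ]ty ≡ wkTy (A [ σ ]ty)
sub-wk-ty ⋆ σ = refl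
sub-wk-ty (s ─⟨ A ⟩⟶ t) σ = arr-cong (sub-wk-tm s σ) (sub-wk-ty A σ) (sub-wk-tm t σ)

sub-wk²-tm : ∀ {n m} (t : Tm n) (σ : Sub n m) →
  t [ wkSub (wkSub σ) ]tm ≡ wkTm (wkTm (t [ σ ]tm))
sub-wk²-tm t σ = trans (sub-wk-tm t (wkSub σ)) (cong wkTm (sub-wk-tm t σ))

sub-wk²-ty : ∀ {n m} (A : Ty n) (σ : Sub n m) →
  A [ wkSub (wkSub σ) ]ty ≡ wkTy (wkTy (A [ σ ]ty))
sub-wk²-ty A σ = trans (sub-wk-ty A (wkSub σ)) (cong wkTy (sub-wk-ty A σ))

lookup-id : ∀ {n} (i : Fin n) → lookupSub idSub i ≡ Var i
lookup-id zero = refl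
lookup-id (suc i) = trans (lookup-wk idSub i) (cong wkTm (lookup-id i))

id-tm : ∀ {n} (t : Tm n) → t [ idSub ]tm ≡ t
∘-id : ∀ {k n} (τ : Sub k n) → τ ∘ idSub ≡ τ
id-tm (Var i) = lookup-id i
id-tm (Coh Δ A τ) = cong (Coh Δ A) (∘-id τ)
∘-id ⟨⟩ = refl
∘-id ⟨ τ , t ⟩ = cong₂ ⟨_,_⟩ (∘-id τ) (id-tm t)

id-ty : ∀ {n} (A : Ty n) → A [ idSub ]ty ≡ A
id-ty ⋆ = refl
id-ty (s ─⟨ A ⟩⟶ t) = arr-cong (id-tm s) (id-ty A) (id-tm t)

id-∘ : ∀ {n m} (σ : Sub n m) → idSub ∘ σ ≡ σ
id-∘ ⟨⟩ = refl
id-∘ ⟨ σ , u ⟩ = cong (λ τ → ⟨ τ , u ⟩) (trans (wk-ext-sub idSub σ u) (id-∘ σ))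

lookup-∘ : ∀ {k n m} (τ : Sub k n) (σ : Sub n m) i →
  lookupSub τ i [ σ ]tm ≡ lookupSub (τ ∘ σ) i
lookup-∘ ⟨ τ , t ⟩ σ zero = refl
lookup-∘ ⟨ τ , t ⟩ σ (suc i) = lookup-∘ τ σ i

assoc-tm : ∀ {k n m} (t : Tm k) (τ : Sub k n) (σ : Sub n m) →
  t [ τ ]tm [ σ ]tm ≡ t [ τ ∘ σ ]tm
assoc-sub : ∀ {j k n m} (ρ : Sub j k) (τ : Sub k n) (σ : Sub n m) →
  (ρ ∘ τ) ∘ σ ≡ ρ ∘ (τ ∘ σ)
assoc-tm (Var i) τ σ = lookup-∘ τ σ i
assoc-tm (Coh Δ A ρ) τ σ = cong (Coh Δ A) (assoc-sub ρ τ σ)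
assoc-sub ⟨⟩ τ σ = refl
assoc-sub ⟨ ρ , t ⟩ τ σ = cong₂ ⟨_,_⟩ (assoc-sub ρ τ σ) (assoc-tm t τ σ)

assoc-ty : ∀ {k n m} (A : Ty k) (τ : Sub k n) (σ : Sub n m) →
  A [ τ ]ty [ σ ]ty ≡ A [ τ ∘ σ ]ty
assoc-ty ⋆ τ σ = refl
assoc-ty (s ─⟨ A ⟩⟶ t) τ σ = arr-cong (assoc-tm s τ σ) (assoc-ty A τ σ) (assoc-tm t τ σ)

disc-last : ∀ {m} (A : Ty m) x → lookupSub (discSub A x) zero ≡ x
disc-last ⋆ x = refl
disc-last (u ─⟨ A ⟩⟶ v) x = refl

sph-disc : ∀ {m} (A : Ty m) x → Sph (dim+1 A) [ discSub A x ]ty ≡ A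
sph'-disc : ∀ {m} (A : Ty m) u v →
  wkTy (Sph (dim+1 A)) [ ⟨ discSub A u , v ⟩ ]ty ≡ A
sph-disc ⋆ x = refl
sph-disc (u ─⟨ A ⟩⟶ v) x =
  trans (wk-ext-ty (Sph' (dim+1 A)) ⟨ discSub A u , v ⟩ x)
        (arr-cong (disc-last A u) (sph'-disc A u v) refl)
sph'-disc A u v = trans (wk-ext-ty (Sph (dim+1 A)) (discSub A u) v) (sph-disc A u)

pruned-wk : ∀ {n m} {Δ : Ctx (suc (suc n))} {x A} {d : Δ ⊢p x ∶ A}
  (p : LocMax d) (σ : Sub (suc (suc n)) m) →
  prunedSub' p (wkSub σ) ≡ wkSub (prunedSub' p σ)
pruned-wk (lm-here d) ⟨ ⟨ σ , _ ⟩ , _ ⟩ = refl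
pruned-wk (lm-intro p) ⟨ ⟨ σ , a ⟩ , b ⟩ =
  cong (λ τ → ⟨ ⟨ τ , wkTm a ⟩ , wkTm b ⟩) (pruned-wk p σ)
pruned-wk (lm-descent p) σ = pruned-wk p σ

refl-tm : ∀ {n} {Γ : Ctx n} (t : Tm n) → Γ ⊢ t ≈ t
refl-ty : ∀ {n} {Γ : Ctx n} (A : Ty n) → Γ ⊢ A ≈ty A
refl-sub : ∀ {k n} {Γ : Ctx n} (σ : Sub k n) → Γ ⊢ σ ≈s σ
refl-tm (Var i) = eq-var i
refl-tm (Coh Δ A σ) = eq-coh (refl-ty A) (refl-sub σ)
refl-ty ⋆ = eqty-star
refl-ty (s ─⟨ A ⟩⟶ t) = eqty-arr (refl-tm s) (refl-ty A) (refl-tm t)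
refl-sub ⟨⟩ = eqs-empty
refl-sub ⟨ σ , t ⟩ = eqs-ext (refl-sub σ) (refl-tm t)

≡⇒≈ : ∀ {n} {Γ : Ctx n} {s t : Tm n} → s ≡ t → Γ ⊢ s ≈ t
≡⇒≈ {t = t} refl = refl-tm t

≡⇒≈ty : ∀ {n} {Γ : Ctx n} {A B : Ty n} → A ≡ B → Γ ⊢ A ≈ty B
≡⇒≈ty {B = B} refl = refl-ty B

≡⇒≈s : ∀ {k n} {Γ : Ctx n} {σ τ : Sub k n} → σ ≡ τ → Γ ⊢ σ ≈s τ
≡⇒≈s {τ = τ} refl = refl-sub τ

trans-ty : ∀ {n} {Γ : Ctx n} {A B C} → Γ ⊢ A ≈ty B → Γ ⊢ B ≈ty C → Γ ⊢ A ≈ty C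
trans-ty eqty-star eqty-star = eqty-star
trans-ty (eqty-arr a b c) (eqty-arr a' b' c') =
  eqty-arr (eq-trans a a') (trans-ty b b') (eq-trans c c')

lookup-cong : ∀ {k n} {Γ : Ctx n} {σ τ : Sub k n} → Γ ⊢ σ ≈s τ →
  ∀ i → Γ ⊢ lookupSub σ i ≈ lookupSub τ i
lookup-cong (eqs-ext e x) zero = x
lookup-cong (eqs-ext e x) (suc i) = lookup-cong e i

cong-tm : ∀ {k n} {Γ : Ctx n} {σ τ : Sub k n} → Γ ⊢ σ ≈s τ →
  (t : Tm k) → Γ ⊢ (t [ σ ]tm) ≈ (t [ τ ]tm)
cong-sub : ∀ {j k n} {Γ : Ctx n} {σ τ : Sub k n} → Γ ⊢ σ ≈s τ →
  (ρ : Sub j k) → Γ ⊢ (ρ ∘ σ) ≈s (ρ ∘ τ)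
cong-tm e (Var i) = lookup-cong e i
cong-tm e (Coh Δ A ρ) = eq-coh (refl-ty A) (cong-sub e ρ)
cong-sub e ⟨⟩ = eqs-empty
cong-sub e ⟨ ρ , t ⟩ = eqs-ext (cong-sub e ρ) (cong-tm e t)

cong-ty : ∀ {k n} {Γ : Ctx n} {σ τ : Sub k n} → Γ ⊢ σ ≈s τ →
  (A : Ty k) → Γ ⊢ (A [ σ ]ty) ≈ty (A [ τ ]ty)
cong-ty e ⋆ = eqty-star
cong-ty e (s ─⟨ A ⟩⟶ t) = eqty-arr (cong-tm e s) (cong-ty e A) (cong-tm e t)

factor-tm : ∀ {k n m} {Γ : Ctx m} {σ : Sub k m} {π : Sub k n} {ρ : Sub n m} →
  Γ ⊢ σ ≈s (π ∘ ρ) → (t : Tm k) → Γ ⊢ (t [ σ ]tm) ≈ (t [ π ]tm [ ρ ]tm)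
factor-tm {π = π} {ρ} e t = eq-trans (cong-tm e t) (≡⇒≈ (sym (assoc-tm t π ρ)))

factor-ty : ∀ {k n m} {Γ : Ctx m} {σ : Sub k m} {π : Sub k n} {ρ : Sub n m} →
  Γ ⊢ σ ≈s (π ∘ ρ) → (A : Ty k) → Γ ⊢ (A [ σ ]ty) ≈ty (A [ π ]ty [ ρ ]ty)
factor-ty {π = π} {ρ} e A = trans-ty (cong-ty e A) (≡⇒≈ty (sym (assoc-ty A π ρ)))

inv-coh : ∀ {k m} {Δ : Ctx k} {Γ : Ctx m} {s t : Tm k} {A : Ty k} {τ : Sub k m} {B} →
  Γ ⊢ Coh Δ (s ─⟨ A ⟩⟶ t) τ ∶ B →
  Γ ⊢ ((s [ τ ]tm) ─⟨ A [ τ ]ty ⟩⟶ (t [ τ ]tm)) ≈ty B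
inv-coh (tm-conv d e) = trans-ty (inv-coh d) e
inv-coh {s = s} {t} {A} {τ} (tm-coh _ _ _ _) = refl-ty ((s [ τ ]tm) ─⟨ A [ τ ]ty ⟩⟶ (t [ τ ]tm))

-- Weakening: every judgement survives extending the context; equality is
-- included because typing refers to it through conversion.

wk-ty : ∀ {n} {Γ : Ctx n} {B A} → Γ ⊢ty A → (Γ ▸ B) ⊢ty wkTy A
wk-tm : ∀ {n} {Γ : Ctx n} {B t A} → Γ ⊢ t ∶ A → (Γ ▸ B) ⊢ wkTm t ∶ wkTy A
wk-s : ∀ {k n} {Γ : Ctx n} {B} {σ : Sub k n} {Δ} → Γ ⊢s σ ∶ Δ → (Γ ▸ B) ⊢s wkSub σ ∶ Δ
wk-eq : ∀ {n} {Γ : Ctx n} {B s t} → Γ ⊢ s ≈ t → (Γ ▸ B) ⊢ wkTm s ≈ wkTm t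
wk-eqty : ∀ {n} {Γ : Ctx n} {B S T} → Γ ⊢ S ≈ty T → (Γ ▸ B) ⊢ wkTy S ≈ty wkTy T
wk-eqs : ∀ {k n} {Γ : Ctx n} {B} {σ τ : Sub k n} → Γ ⊢ σ ≈s τ → (Γ ▸ B) ⊢ wkSub σ ≈s wkSub τ

wk-ty ty-star = ty-star
wk-ty (ty-arr a b c) = ty-arr (wk-ty a) (wk-tm b) (wk-tm c)

wk-tm (tm-var i) = tm-var (suc i)
wk-tm (tm-conv d e) = tm-conv (wk-tm d) (wk-eqty e)
wk-tm {Γ = Γ} {B = B} (tm-coh {Δ = Δ} {s = s} {t} {A} {σ} P dA dσ sc) =
  subst (λ T → (Γ ▸ B) ⊢ Coh Δ (s ─⟨ A ⟩⟶ t) (wkSub σ) ∶ T)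
    (arr-cong (sub-wk-tm s σ) (sub-wk-ty A σ) (sub-wk-tm t σ))
    (tm-coh P dA (wk-s dσ) sc)

wk-s sub-empty = sub-empty
wk-s {Γ = Γ} {B = B} (sub-ext {σ = σ} {A = A} {t = u} dσ dA du) =
  sub-ext (wk-s dσ) dA (subst (λ T → (Γ ▸ B) ⊢ wkTm u ∶ T) (sym (sub-wk-ty A σ)) (wk-tm du))

wk-eq (eq-var i) = eq-var (suc i)
wk-eq (eq-sym e) = eq-sym (wk-eq e)
wk-eq (eq-trans e f) = eq-trans (wk-eq e) (wk-eq f)
wk-eq (eq-coh a s) = eq-coh a (wk-eqs s)
wk-eq {Γ = Γ} {B = B} (eq-prune {Δ = Δ} {A = A} {σ = σ} (pc d) α (k , τ , α≡) dc) =
  subst (λ ρ → (Γ ▸ B) ⊢ Coh Δ A (wkSub σ) ≈ Coh (prunedCtx' α) (A [ π' α ]ty) ρ)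
    (pruned-wk α σ)
    (eq-prune (pc d) α (k , wkSub τ , wk-identity) (wk-tm dc))
  where
    wk-identity : lookupSub (wkSub σ) (lmVar' α) ≡ 𝕚 k [ wkSub τ ]tm
    wk-identity = trans (lookup-wk σ (lmVar' α))
                        (trans (cong wkTm α≡) (sym (sub-wk-tm (𝕚 k) τ)))
wk-eq {Γ = Γ} {B = B} (eq-disc k {σ} dc) =
  subst (λ u → (Γ ▸ B) ⊢ Coh (D (suc k)) (Sph (suc k)) (wkSub σ) ≈ u)
    (lookup-wk σ zero) (eq-disc k (wk-tm dc))
wk-eq {Γ = Γ} {B = B} (eq-endo {Δ = Δ} {t = t} {A} {σ} dc) =
  subst (λ u → (Γ ▸ B) ⊢ Coh Δ (t ─⟨ A ⟩⟶ t) (wkSub σ) ≈ u)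
    (trans (cong (λ τ → 𝕚 (dim+1 A) [ τ ]tm) (∘-wk (discSub A t) σ))
           (sub-wk-tm (𝕚 (dim+1 A)) (discSub A t ∘ σ)))
    (eq-endo (wk-tm dc))

wk-eqty eqty-star = eqty-star
wk-eqty (eqty-arr a b c) = eqty-arr (wk-eq a) (wk-eqty b) (wk-eq c)

wk-eqs eqs-empty = eqs-empty
wk-eqs (eqs-ext e x) = eqs-ext (wk-eqs e) (wk-eq x)

data Wf : ∀ {n} → Ctx n → Set where
  wf∅ : Wf ∅
  wf▸ : ∀ {n} {Γ : Ctx n} {A} → Wf Γ → Γ ⊢ty A → Wf (Γ ▸ A)

pasting-wf : ∀ {n} {Γ : Ctx n} {x A} → Γ ⊢p x ∶ A → Wf Γ × Γ ⊢ x ∶ A × Γ ⊢ty A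
pasting-wf pc-base = wf▸ wf∅ ty-star , tm-var zero , ty-star
pasting-wf (pc-intro d) with pasting-wf d
... | W , dx , dA =
  wf▸ (wf▸ W dA) (ty-arr (wk-ty dA) (wk-tm dx) (tm-var zero)) ,
  tm-var zero ,
  ty-arr (wk-ty (wk-ty dA)) (wk-tm (wk-tm dx)) (tm-var (suc zero))
pasting-wf (pc-descent d) with pasting-wf d
... | W , dx , ty-arr dA _ dy = W , dy , dA

descend-to-⋆ : ∀ {n} {Γ : Ctx n} {x} (A : Ty n) → Γ ⊢p x ∶ A → Γ ⊢p
descend-to-⋆ ⋆ d = pc d
descend-to-⋆ (s ─⟨ A ⟩⟶ t) d = descend-to-⋆ A (pc-descent d)

id-typing : ∀ {n} {Γ : Ctx n} → Wf Γ → Γ ⊢s idSub ∶ Γ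
id-typing wf∅ = sub-empty
id-typing {Γ = Γ ▸ A} (wf▸ W dA) =
  sub-ext (wk-s (id-typing W)) dA
    (subst (λ T → (Γ ▸ A) ⊢ Var zero ∶ T)
      (sym (trans (sub-wk-ty A idSub) (cong wkTy (id-ty A)))) (tm-var zero))


disc-pasting : ∀ k → D k ⊢p Var zero ∶ Sph k
disc-pasting zero = pc-base
disc-pasting (suc k) = pc-intro (disc-pasting k)

disc-wf : ∀ k → Wf (D k)
disc-wf k = proj₁ (pasting-wf (disc-pasting k))

top-typing : ∀ k → D k ⊢ Var zero ∶ Sph k
top-typing k = proj₁ (proj₂ (pasting-wf (disc-pasting k)))

sph-typing : ∀ k → D k ⊢ty Sph k
sph-typing k = proj₂ (proj₂ (pasting-wf (disc-pasting k)))

sph'-typing : ∀ k → (D k ▸ Sph k) ⊢ty Sph' k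
sph'-typing k with disc-wf (suc k)
... | wf▸ _ dS' = dS'

disc-sub-typing : ∀ {m} {Γ : Ctx m} {A x} → Γ ⊢ty A → Γ ⊢ x ∶ A →
  Γ ⊢s discSub A x ∶ D (dim+1 A)
disc-sub-typing ty-star dx = sub-ext sub-empty ty-star dx
disc-sub-typing {Γ = Γ} {x = x} (ty-arr {s = u} {A} {v} dA du dv) dx =
  sub-ext (sub-ext (disc-sub-typing dA du) (sph-typing (dim+1 A))
                   (subst (Γ ⊢ v ∶_) (sym (sph-disc A u)) dv))
          (sph'-typing (dim+1 A))
          (subst (Γ ⊢ x ∶_) (sym (arr-cong (disc-last A u) (sph'-disc A u v) refl)) dx)

fv-wk-tm : ∀ {n} {i : Fin n} {t} → i ∈FVtm t → suc i ∈FVtm wkTm t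
fv-wk-sub : ∀ {k n} {i : Fin n} {σ : Sub k n} → i ∈FVsub σ → suc i ∈FVsub wkSub σ
fv-wk-tm fv-var = fv-var
fv-wk-tm (fv-coh x) = fv-coh (fv-wk-sub x)
fv-wk-sub (fv-head x) = fv-head (fv-wk-tm x)
fv-wk-sub (fv-tail x) = fv-tail (fv-wk-sub x)

fv-wk-ty : ∀ {n} {i : Fin n} {A} → i ∈FVty A → suc i ∈FVty wkTy A
fv-wk-ty (fv-src x) = fv-src (fv-wk-tm x)
fv-wk-ty (fv-base x) = fv-base (fv-wk-ty x)
fv-wk-ty (fv-tgt x) = fv-tgt (fv-wk-tm x)

supp-wk² : ∀ {n} {Γ : Ctx n} {A B j i} → InSupp Γ (Var j) i →
  InSupp (Γ ▸ A ▸ B) (Var (suc (suc j))) (suc (suc i))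
supp-wk² (supp-fv fv-var) = supp-fv fv-var
supp-wk² (supp-down s f) = supp-down (supp-wk² s) (fv-wk-ty (fv-wk-ty f))

supp-trans : ∀ {n} {Γ : Ctx n} {t j i} → InSupp Γ (Var j) i → InSupp Γ t j → InSupp Γ t i
supp-trans (supp-fv fv-var) h = h
supp-trans (supp-down s f) h = supp-down (supp-trans s h) f

disc-top-supp : ∀ k i → InSupp (D k) (Var zero) i
disc-top-supp zero zero = supp-fv fv-var
disc-top-supp (suc k) zero = supp-fv fv-var
disc-top-supp (suc k) (suc zero) = supp-down (supp-fv fv-var) (fv-tgt fv-var)
disc-top-supp (suc k) (suc (suc i)) =
  supp-trans (supp-wk² (disc-top-supp k i)) (supp-down (supp-fv fv-var) (fv-src fv-var))

disc-supp-cond : ∀ k → SuppCond (D k) (Var zero) (Var zero)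
disc-supp-cond k = inj₂ (full , full)
  where
    full : InSupp (D k) (Var zero) ≐ FVctx (D k)
    full i = (λ _ → tt) , (λ _ → disc-top-supp k i)

identity-typing : ∀ {m} {Γ : Ctx m} {A x} → Γ ⊢ty A → Γ ⊢ x ∶ A →
  Γ ⊢ 𝕚 (dim+1 A) [ discSub A x ]tm ∶ (x ─⟨ A ⟩⟶ x)
identity-typing {Γ = Γ} {A} {x} dA dx =
  subst (Γ ⊢ 𝕚 k [ discSub A x ]tm ∶_) (arr-cong top≡ sph≡ top≡)
    (tm-coh (descend-to-⋆ (Sph k) (disc-pasting k))
            (ty-arr (sph-typing k) (top-typing k) (top-typing k))
            (subst (Γ ⊢s_∶ D k) (sym (id-∘ (discSub A x))) (disc-sub-typing dA dx))
            (disc-supp-cond k))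
  where
    k = dim+1 A
    top≡ : lookupSub (idSub ∘ discSub A x) zero ≡ x
    top≡ = trans (cong (λ τ → lookupSub τ zero) (id-∘ (discSub A x))) (disc-last A x)
    sph≡ : Sph k [ idSub ∘ discSub A x ]ty ≡ A
    sph≡ = trans (cong (Sph k [_]ty) (id-∘ (discSub A x))) (sph-disc A x)


disc-determined : ∀ {m n} {Γ : Ctx m} k (τ : Sub (dsz k) m)
  (B : Ty n) (u : Tm n) (ρ : Sub n m) →
  Γ ⊢ (Sph k [ τ ]ty) ≈ty (B [ ρ ]ty) → Γ ⊢ lookupSub τ zero ≈ (u [ ρ ]tm) →
  Σ (k ≡ dim+1 B) λ k≡ → Γ ⊢ subst (λ j → Sub (dsz j) m) k≡ τ ≈s (discSub B u ∘ ρ)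
disc-determined zero ⟨ ⟨⟩ , _ ⟩ ⋆ u ρ _ top≈ = refl , eqs-ext eqs-empty top≈
disc-determined zero _ (_ ─⟨ _ ⟩⟶ _) u ρ () _
disc-determined (suc k) ⟨ ⟨ _ , _ ⟩ , _ ⟩ ⋆ u ρ () _
disc-determined {Γ = Γ} (suc k) ⟨ ⟨ τ , v ⟩ , w ⟩ (u' ─⟨ B ⟩⟶ v') u ρ
  (eqty-arr src≈ base≈ tgt≈) top≈
  with disc-determined k τ B u' ρ
         (subst (λ T → Γ ⊢ T ≈ty (B [ ρ ]ty)) (wk²-ext-ty (Sph k) τ v w) base≈) src≈
... | refl , τ≈ = refl , eqs-ext (eqs-ext τ≈ tgt≈) top≈

identity-inversion : ∀ {m n} {Γ : Ctx m} k (τ : Sub (dsz k) m)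
  (A : Ty n) (x : Tm n) (ρ : Sub n m) {y} →
  Γ ⊢ 𝕚 k [ τ ]tm ∶ ((x [ ρ ]tm) ─⟨ A [ ρ ]ty ⟩⟶ y) →
  Γ ⊢ y ≈ (x [ ρ ]tm) × Γ ⊢ 𝕚 k [ τ ]tm ≈ (𝕚 (dim+1 A) [ discSub A x ]tm [ ρ ]tm)
identity-inversion {Γ = Γ} k τ A x ρ di with inv-coh di
... | eqty-arr src≈ base≈ tgt≈ with disc-determined k (idSub ∘ τ) A x ρ base≈ src≈
...   | refl , τ≈ =
  eq-trans (eq-sym tgt≈) src≈ ,
  eq-coh (refl-ty _)
    (subst (Γ ⊢ idSub ∘ τ ≈s_) (cong (_∘ ρ) (sym (id-∘ (discSub A x)))) τ≈)


-- Δ//α is again a pasting context (pruning removes an intro/descent pair).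
pruned-pasting : ∀ {n} {Δ : Ctx (suc (suc n))} {x A} {d : Δ ⊢p x ∶ A} (p : LocMax d) →
  prunedCtx' p ⊢p (x [ π' p ]tm) ∶ (A [ π' p ]ty)
pruned-pasting (lm-here {x = x} {A = A} d) =
  subst (_ ⊢p x ∶_) (sym (trans (wk²-ext-ty A idSub x _) (id-ty A))) d
pruned-pasting (lm-intro {x = x} {A = A} {d = d} p) =
  subst (prunedCtx' (lm-intro {d = d} p) ⊢p Var zero ∶_)
    (sym (arr-cong (trans (wk²-ext-tm x (wkSub (wkSub (π' p))) _ _) (sub-wk²-tm x (π' p)))
                   (trans (wk²-ext-ty A (wkSub (wkSub (π' p))) _ _) (sub-wk²-ty A (π' p)))
                   refl))
    (pc-intro (pruned-pasting p))
pruned-pasting (lm-descent p) = pc-descent (pruned-pasting p)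

π-typing : ∀ {n} {Δ : Ctx (suc (suc n))} {x A} {d : Δ ⊢p x ∶ A} (p : LocMax d) →
  prunedCtx' p ⊢s π' p ∶ Δ
π-typing (lm-here {Γ = Γ} {x = x} {A = A} d) with pasting-wf d
... | W , dx , dA =
  sub-ext (sub-ext (id-typing W) dA (subst (Γ ⊢ x ∶_) (sym (id-ty A)) dx))
    (ty-arr (wk-ty dA) (wk-tm dx) (tm-var zero))
    (subst (Γ ⊢ 𝕚 (dim+1 A) [ discSub A x ]tm ∶_)
      (sym (arr-cong (trans (wk-ext-tm x idSub x) (id-tm x))
                     (trans (wk-ext-ty A idSub x) (id-ty A)) refl))
      (identity-typing dA dx))
π-typing (lm-intro {x = x} {A = A} {d = d} p) with pasting-wf d
... | W , dx , dA =
  sub-ext (sub-ext (wk-s (wk-s (π-typing p))) dA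
                   (subst (Δ' ⊢ Var (suc zero) ∶_) (sym (sub-wk²-ty A (π' p))) (tm-var (suc zero))))
    (ty-arr (wk-ty dA) (wk-tm dx) (tm-var zero))
    (subst (Δ' ⊢ Var zero ∶_)
      (sym (arr-cong (trans (wk-ext-tm x π² (Var (suc zero))) (sub-wk²-tm x (π' p)))
                     (trans (wk-ext-ty A π² (Var (suc zero))) (sub-wk²-ty A (π' p)))
                     refl))
      (tm-var zero))
  where
    Δ' = prunedCtx' (lm-intro {d = d} p)
    π² = wkSub (wkSub (π' p))
π-typing (lm-descent p) = π-typing p

pruning-factorisation : ∀ {n m} {Δ : Ctx (suc (suc n))} {Γ : Ctx m} {x A}
  {d : Δ ⊢p x ∶ A} (p : LocMax d) {σ : Sub (suc (suc n)) m} →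
  Γ ⊢s σ ∶ Δ → IsIdentity (Var (lmVar' p) [ σ ]tm) →
  Γ ⊢ σ ≈s (π' p ∘ prunedSub' p σ)
pruning-factorisation {Γ = Γ} (lm-here {x = x} {A = A} d) {⟨ ⟨ σ , y ⟩ , _ ⟩}
  (sub-ext (sub-ext _ _ _) _ dα) (k , τ , refl)
  with identity-inversion k τ A x σ
         (subst (Γ ⊢ 𝕚 k [ τ ]tm ∶_) (arr-cong (wk-ext-tm x σ y) (wk-ext-ty A σ y) refl) dα)
... | y≈x , α≈ = eqs-ext (eqs-ext (≡⇒≈s (sym (id-∘ σ))) y≈x) α≈
pruning-factorisation (lm-intro p) {⟨ ⟨ σ , a ⟩ , b ⟩} (sub-ext (sub-ext dσ _ _) _ _) isId =
  eqs-ext (eqs-ext σ≈ (refl-tm a)) (refl-tm b)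
  where
    σ≈ : _ ⊢ σ ≈s (wkSub (wkSub (π' p)) ∘ ⟨ ⟨ prunedSub' p σ , a ⟩ , b ⟩)
    σ≈ = subst (_ ⊢ σ ≈s_) (sym (wk²-ext-sub (π' p) (prunedSub' p σ) a b))
               (pruning-factorisation p dσ isId)
pruning-factorisation (lm-descent p) dσ isId = pruning-factorisation p dσ isId

-- Third part:  Γ ⊢ σ//α : Δ//α.  The new entries are retyped along the
-- factorisation of the part of σ below them.
pruned-sub-typing : ∀ {n m} {Δ : Ctx (suc (suc n))} {Γ : Ctx m} {x A}
  {d : Δ ⊢p x ∶ A} (p : LocMax d) {σ : Sub (suc (suc n)) m} →
  Γ ⊢s σ ∶ Δ → IsIdentity (Var (lmVar' p) [ σ ]tm) →
  Γ ⊢s prunedSub' p σ ∶ prunedCtx' p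
pruned-sub-typing (lm-here d) (sub-ext (sub-ext dσ _ _) _ _) _ = dσ
pruned-sub-typing (lm-intro {x = x} {A = A} {d = d} p) {⟨ ⟨ σ , a ⟩ , b ⟩}
  (sub-ext (sub-ext dσ _ da) _ db) isId
  with pasting-wf (pruned-pasting (lm-intro {d = d} p))
... | wf▸ (wf▸ _ dAπ) dTπ , _ =
  sub-ext (sub-ext (pruned-sub-typing p dσ isId) dAπ (tm-conv da A≈))
          dTπ (tm-conv db (eqty-arr x≈ A≈' (refl-tm a)))
  where
    ρ = prunedSub' p σ
    σ≈ = pruning-factorisation p dσ isId
    A≈ = factor-ty σ≈ A
    x≈ = eq-trans (≡⇒≈ (wk-ext-tm x σ a))
           (eq-trans (factor-tm σ≈ x) (≡⇒≈ (sym (wk-ext-tm (x [ π' p ]tm) ρ a))))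
    A≈' = trans-ty (≡⇒≈ty (wk-ext-ty A σ a))
           (trans-ty A≈ (≡⇒≈ty (sym (wk-ext-ty (A [ π' p ]ty) ρ a))))
pruned-sub-typing (lm-descent p) dσ isId = pruned-sub-typing p dσ isId

mainTheorem13 : ∀ {n m} {Δ : Ctx (suc (suc n))} {Γ : Ctx m}
    {σ : Sub (suc (suc n)) m} (P : Δ ⊢p) (α : LocMaxVar P) →
    Γ ⊢s σ ∶ Δ →
    IsIdentity (Var (lmVar α) [ σ ]tm) →
    ((Δ // α) ⊢s π[ α ] ∶ Δ)
      × (Γ ⊢s (σ //s α) ∶ (Δ // α))
      × (Γ ⊢ σ ≈s (π[ α ] ∘ (σ //s α)))
mainTheorem13 (pc d) α dσ isId =
  π-typing α , pruned-sub-typing α dσ isId , pruning-factorisation α dσ isId
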